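{- Let $n\geq 3$ and let $D_n=\langle r,s \mid r^n=s^2=rsrs=e\rangle$ be the dihedral group of order $2n$. If $n$ is odd, Player 1 has a winning strategy for $\texttt{REL}(D_n,\{r,s\})$. If $n$ is even, Player 1 has a winning strategy for $\texttt{REL}(D_n,\{r,s\})$ when $n\equiv 2 \pmod 6$, and Player 2 has a winning strategy otherwise.
   Context: Game $\texttt{REL}(G,S)$: $G$ is a finite group and $S$ a generating set with $e\notin S$. Two players alternate turns, Player 1 first, starting from the empty word $w_0$. On turn $n$ the current player chooses $s_n\in S\cup S^{ -1}$, subject to $s_n\neq s_{n-1}^{ -1}$ when $n>1$, and forms $w_n=w_{n-1}s_n$. If $w_n$ represents the same element of $G$ as some $w_k$ with $0\le k<n$, the player who formed $w_n$ wins. If a player has no legal move, that player loses. -}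

module Defs where

open import Data.Nat using (ℕ; zero; suc; _+_; _∸_; NonZero)
open import Data.Nat.DivMod using (_mod_)
open import Data.Fin using (Fin; toℕ)
open import Data.Bool using (Bool; true; false; not; _xor_; if_then_else_)
open import Data.Product using (_×_; _,_)
open import Data.Maybe using (Maybe; just; nothing)
open import Data.List using (List; []; _∷_; _++_; map)
open import Data.List.Membership.Propositional using (_∈_; _∉_)
open import Data.Unit using (⊤)
open import Data.Sum using (_⊎_)
open import Relation.Binary.PropositionalEquality using (_≢_)

-- A word w_n is tracked by the group element it
-- represents; `hist` is the list of elements represented by w_0,...,w_n
-- (including the current one), `cur` is the element of the current word,
-- and `lst` is the previous move s_n (nothing on the first turn).

module REL (G : Set) (_·_ : G → G → G) (_⁻¹ : G → G) (e : G) (S : List G) where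

  Moves : List G
  Moves = S ++ map _⁻¹ S

  Legal : Maybe G → G → Set
  Legal nothing  m = ⊤
  Legal (just p) m = m ≢ p ⁻¹

  -- Win h c l : the player about to move has a winning strategy.
  -- Lose h c l : the player about to move loses against every play
  --              (i.e. the other player has a winning strategy).
  -- Inductive, since the game is finite.
  data Win (hist : List G) (cur : G) (lst : Maybe G) : Set
  data Lose (hist : List G) (cur : G) (lst : Maybe G) : Set

  data Win hist cur lst where
    win : (m : G) → m ∈ Moves → Legal lst m →
          ((cur · m) ∈ hist ⊎ Lose ((cur · m) ∷ hist) (cur · m) (just m)) →
          Win hist cur lst

  data Lose hist cur lst where
    lose : ((m : G) → m ∈ Moves → Legal lst m →
             ((cur · m) ∉ hist) × Win ((cur · m) ∷ hist) (cur · m) (just m)) →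
           Lose hist cur lst

  -- initial position: empty word w_0 = e, Player 1 to move
  Player1Wins : Set
  Player1Wins = Win (e ∷ []) e nothing

  Player2Wins : Set
  Player2Wins = Lose (e ∷ []) e nothing

-- The dihedral group D_n of order 2n, concretely: (k , b) stands for
-- r^k s^b (b = true means one factor s), with k ∈ ℤ/n.

module Dihedral (n : ℕ) .{{_ : NonZero n}} where

  _+ₙ_ : Fin n → Fin n → Fin n
  a +ₙ b = (toℕ a + toℕ b) mod n

  -ₙ_ : Fin n → Fin n
  -ₙ a = (n ∸ toℕ a) mod n

  D : Set
  D = Fin n × Bool

  -- r^a s^f · r^b s^g = r^(a ± b) s^(f xor g), using s r^b = r^(-b) s
  _·_ : D → D → D
  (a , f) · (b , g) = (a +ₙ (if f then -ₙ b else b)) , (f xor g)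

  _⁻¹ : D → D
  (a , false) ⁻¹ = (-ₙ a) , false
  (a , true)  ⁻¹ = a , true

  e : D
  e = (0 mod n) , false

  r : D
  r = (1 mod n) , false

  s : D
  s = (0 mod n) , true

  open REL D _·_ _⁻¹ e (r ∷ s ∷ []) public

P1WinsDihedral : (n : ℕ) .{{_ : NonZero n}} → Set
P1WinsDihedral n = Dihedral.Player1Wins n

P2WinsDihedral : (n : ℕ) .{{_ : NonZero n}} → Set
P2WinsDihedral n = Dihedral.Player2Wins n

{-# OPTIONS --safe #-}
module Submission where

-- The Cayley graph of D_n for {r, s} is a prism: the cosets of ⟨r⟩ are two n-cycles (layers) joined
-- by the s-edges.  Once play has left the start column it runs round the prism in one direction: the
-- player to move either steps forward in his layer or crosses to the other one; after a crossing the
-- opponent must step forward too, since stepping back either revisits a cell (and wins) or lets the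
-- mover cross back into a visited cell.  Hence only the cells of the column just left and of the
-- start column matter, and the outcome satisfies a Boolean recursion in the number of columns left
-- (moverWins).  That recursion has period 6; evaluating it for Player 1's openings r and s (r⁻¹ is
-- the mirror image of r) gives the classification by n mod 6.

open import Defs
open import Data.Nat using (ℕ; zero; suc; _+_; _*_; _∸_; _≤_; _<_; z≤n; s≤s; z<s; NonZero; _%_; _/_)
open import Data.Nat.Properties
open import Data.Nat.DivMod
open import Data.Fin using (Fin; toℕ)
open import Data.Fin.Properties using (toℕ-injective; toℕ<n; toℕ-fromℕ<)
open import Data.Bool using (Bool; true; false; not; _∧_; _∨_)
open import Data.Bool.Properties using (not-involutive; not-¬)
open import Data.Product using (_×_; _,_; proj₁; proj₂; uncurry)
open import Data.Sum using (_⊎_; inj₁; inj₂)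
open import Data.Maybe using (Maybe; just; nothing)
import Data.Maybe as Maybe
open import Data.List using (List; []; _∷_; map)
open import Data.List.Properties using (map-∘; map-cong; map-id)
open import Data.List.Membership.Propositional using (_∈_; _∉_)
open import Data.List.Membership.Propositional.Properties using (∈-map⁺)
open import Data.List.Relation.Unary.Any using (here; there)
open import Data.Unit using (tt)
open import Data.Empty using (⊥-elim)
open import Function using (_∘_)
open import Relation.Binary.PropositionalEquality
open import Algebra.Properties.CommutativeSemigroup +-commutativeSemigroup using (interchange)

module Automorphism
  {G : Set} {_·_ : G → G → G} {_⁻¹ : G → G} {e : G} {S : List G}
  (φ : G → G)
  (φ-involutive : ∀ x → φ (φ x) ≡ x)
  (φ-homo : ∀ x y → φ (x · y) ≡ φ x · φ y)
  (φ-⁻¹ : ∀ x → φ (x ⁻¹) ≡ φ x ⁻¹)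
  (φ-moves : ∀ {m} → m ∈ REL.Moves G _·_ _⁻¹ e S → φ m ∈ REL.Moves G _·_ _⁻¹ e S)
  where

  open REL G _·_ _⁻¹ e S

  map-φ-involutive : ∀ h → map φ (map φ h) ≡ h
  map-φ-involutive h = trans (sym (map-∘ h)) (trans (map-cong φ-involutive h) (map-id h))

  ∈-map-φ⁻ : ∀ {x h} → φ x ∈ map φ h → x ∈ h
  ∈-map-φ⁻ {x} {h} x∈ = subst₂ _∈_ (φ-involutive x) (map-φ-involutive h) (∈-map⁺ φ x∈)

  φ-injective : ∀ {x y} → φ x ≡ φ y → x ≡ y
  φ-injective {x} {y} eq = trans (sym (φ-involutive x)) (trans (cong φ eq) (φ-involutive y))

  legal-φ : ∀ l {m} → Legal l m → Legal (Maybe.map φ l) (φ m)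
  legal-φ nothing  _     = tt
  legal-φ (just p) legal eq = legal (φ-injective (trans eq (sym (φ-⁻¹ p))))

  legal-φ⁻ : ∀ l {m} → Legal (Maybe.map φ l) m → Legal l (φ m)
  legal-φ⁻ nothing  _     = tt
  legal-φ⁻ (just p) legal eq = legal (trans (sym (φ-involutive _)) (trans (cong φ eq) (φ-⁻¹ p)))

  win-φ : ∀ {h c l} → Win h c l → Win (map φ h) (φ c) (Maybe.map φ l)
  lose-φ : ∀ {h c l} → Lose h c l → Lose (map φ h) (φ c) (Maybe.map φ l)

  win-φ {h} {c} {l} (win m m∈ legal (inj₁ revisit)) =
    win (φ m) (φ-moves m∈) (legal-φ l legal) (inj₁ (subst (_∈ map φ h) (φ-homo c m) (∈-map⁺ φ revisit)))
  win-φ {h} {c} {l} (win m m∈ legal (inj₂ lost)) =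
    win (φ m) (φ-moves m∈) (legal-φ l legal)
        (inj₂ (subst (λ y → Lose (y ∷ map φ h) y (just (φ m))) (φ-homo c m) (lose-φ lost)))

  lose-φ {h} {c} {l} (lose reply) = lose λ m m∈ legal →
    let fresh , won = reply (φ m) (φ-moves m∈) (legal-φ⁻ l legal)
    in  (λ revisit → fresh (∈-map-φ⁻ (subst (_∈ map φ h) (sym (φ-c·φm m)) revisit))) ,
        subst₂ (λ y m′ → Win (y ∷ map φ h) y (just m′)) (φ-c·φm m) (φ-involutive m) (win-φ won)
    where
    φ-c·φm : ∀ m → φ (c · φ m) ≡ φ c · m
    φ-c·φm m = trans (φ-homo c (φ m)) (cong (φ c ·_) (φ-involutive m))

  win-φ⁻ : ∀ {h c m} → Win (map φ h) (φ c) (just (φ m)) → Win h c (just m)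
  win-φ⁻ {h} {c} {m} w =
    subst₂ (λ h′ c′ → Win h′ c′ (just m)) (map-φ-involutive h) (φ-involutive c)
      (subst (λ m′ → Win _ _ (just m′)) (φ-involutive m) (win-φ w))

module Coordinates (m : ℕ) where

  n : ℕ
  n = suc (suc m)

  open Dihedral n public

  col : D → ℕ
  col = toℕ ∘ proj₁

  lay : D → Bool
  lay = proj₂

  D-≡ : ∀ {x y} → col x ≡ col y → lay x ≡ lay y → x ≡ y
  D-≡ {a , _} {b , _} a≡b refl = cong (_, _) (toℕ-injective a≡b)

  toℕ-+ₙ : ∀ a b → toℕ (a +ₙ b) ≡ (toℕ a + toℕ b) % n
  toℕ-+ₙ a b = toℕ-fromℕ< _

  toℕ--ₙ : ∀ a → toℕ (-ₙ a) ≡ (n ∸ toℕ a) % n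
  toℕ--ₙ a = toℕ-fromℕ< _

  ∸-inverse : ∀ u → u ≤ n → (u + (n ∸ u) % n) % n ≡ 0
  ∸-inverse u u≤n = begin
    (u + (n ∸ u) % n) % n         ≡⟨ %-distribˡ-+ u ((n ∸ u) % n) n ⟩
    (u % n + (n ∸ u) % n % n) % n ≡⟨ cong (λ w → (u % n + w) % n) (m%n%n≡m%n (n ∸ u) n) ⟩
    (u % n + (n ∸ u) % n) % n     ≡⟨ sym (%-distribˡ-+ u (n ∸ u) n) ⟩
    (u + (n ∸ u)) % n             ≡⟨ cong (_% n) (m+[n∸m]≡n u≤n) ⟩
    n % n                         ≡⟨ n%n≡0 n ⟩
    0                             ∎
    where open ≡-Reasoning

  ∸-inverse-unique : ∀ u v → u ≤ n → v < n → (u + v) % n ≡ 0 → v ≡ (n ∸ u) % n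
  ∸-inverse-unique u v u≤n v<n u+v≡0 = trans (sym via-v) via-inverse
    where
    open ≡-Reasoning
    w = (n ∸ u) % n

    via-inverse : (w + (u + v)) % n ≡ w
    via-inverse = begin
      (w + (u + v)) % n         ≡⟨ %-distribˡ-+ w (u + v) n ⟩
      (w % n + (u + v) % n) % n ≡⟨ cong₂ (λ a b → (a + b) % n) (m%n%n≡m%n (n ∸ u) n) u+v≡0 ⟩
      (w + 0) % n               ≡⟨ cong (_% n) (+-identityʳ w) ⟩
      w % n                     ≡⟨ m%n%n≡m%n (n ∸ u) n ⟩
      w                         ∎

    via-v : (w + (u + v)) % n ≡ v
    via-v = begin
      (w + (u + v)) % n         ≡⟨ cong (_% n) (trans (sym (+-assoc w u v)) (cong (_+ v) (+-comm w u))) ⟩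
      (u + w + v) % n           ≡⟨ %-distribˡ-+ (u + w) v n ⟩
      ((u + w) % n + v % n) % n ≡⟨ cong (λ a → (a + v % n) % n) (∸-inverse u u≤n) ⟩
      v % n % n                 ≡⟨ m%n%n≡m%n v n ⟩
      v % n                     ≡⟨ m<n⇒m%n≡m v<n ⟩
      v                         ∎

  toℕ≤n : ∀ (a : Fin n) → toℕ a ≤ n
  toℕ≤n a = <⇒≤ (toℕ<n a)

  -ₙ-inverse : ∀ a → (toℕ a + toℕ (-ₙ a)) % n ≡ 0
  -ₙ-inverse a = trans (cong (λ w → (toℕ a + w) % n) (toℕ--ₙ a)) (∸-inverse (toℕ a) (toℕ≤n a))

  -ₙ-unique : ∀ a b → (toℕ a + toℕ b) % n ≡ 0 → b ≡ -ₙ a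
  -ₙ-unique a b a+b≡0 =
    toℕ-injective (trans (∸-inverse-unique (toℕ a) (toℕ b) (toℕ≤n a) (toℕ<n b) a+b≡0) (sym (toℕ--ₙ a)))

  -ₙ-involutive : ∀ a → -ₙ (-ₙ a) ≡ a
  -ₙ-involutive a = sym (-ₙ-unique (-ₙ a) a (trans (cong (_% n) (+-comm (toℕ (-ₙ a)) (toℕ a))) (-ₙ-inverse a)))

  -ₙ-distrib-+ₙ : ∀ a b → -ₙ (a +ₙ b) ≡ (-ₙ a) +ₙ (-ₙ b)
  -ₙ-distrib-+ₙ a b = sym (-ₙ-unique (a +ₙ b) ((-ₙ a) +ₙ (-ₙ b)) (begin
    (toℕ (a +ₙ b) + toℕ ((-ₙ a) +ₙ (-ₙ b))) % n
      ≡⟨ cong₂ (λ u v → (u + v) % n) (toℕ-+ₙ a b) (toℕ-+ₙ (-ₙ a) (-ₙ b)) ⟩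
    ((A + B) % n + (A′ + B′) % n) % n       ≡⟨ sym (%-distribˡ-+ (A + B) (A′ + B′) n) ⟩
    ((A + B) + (A′ + B′)) % n               ≡⟨ cong (_% n) (interchange A B A′ B′) ⟩
    ((A + A′) + (B + B′)) % n               ≡⟨ %-distribˡ-+ (A + A′) (B + B′) n ⟩
    ((A + A′) % n + (B + B′) % n) % n       ≡⟨ cong₂ (λ u v → (u + v) % n) (-ₙ-inverse a) (-ₙ-inverse b) ⟩
    0                                       ∎))
    where
    open ≡-Reasoning
    A = toℕ a
    B = toℕ b
    A′ = toℕ (-ₙ a)
    B′ = toℕ (-ₙ b)

  toℕ--ₙ1 : toℕ (-ₙ (1 mod n)) ≡ n ∸ 1
  toℕ--ₙ1 = trans (toℕ--ₙ (1 mod n)) (m<n⇒m%n≡m ≤-refl)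

  -ₙ0 : -ₙ (0 mod n) ≡ 0 mod n
  -ₙ0 = toℕ-injective (trans (toℕ--ₙ (0 mod n)) (n%n≡0 n))

  -- Right multiplication by r raises the column in layer false and lowers it in layer true.
  fwd bwd : Bool → D
  fwd false = r
  fwd true  = r ⁻¹
  bwd false = r ⁻¹
  bwd true  = r

  col-fwd : ∀ {x X} → lay x ≡ X → col (x · fwd X) ≡ suc (col x) % n
  col-fwd {a , false} refl = trans (toℕ-+ₙ a (1 mod n)) (cong (_% n) (+-comm (toℕ a) 1))
  col-fwd {a , true}  refl = trans (toℕ-+ₙ a _)
    (trans (cong (λ b → (toℕ a + toℕ b) % n) (-ₙ-involutive (1 mod n))) (cong (_% n) (+-comm (toℕ a) 1)))

  col-bwd : ∀ {x X} → lay x ≡ X → col (x · bwd X) ≡ (col x + (n ∸ 1)) % n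
  col-bwd {a , false} refl = trans (toℕ-+ₙ a _) (cong (λ b → (toℕ a + b) % n) toℕ--ₙ1)
  col-bwd {a , true}  refl = trans (toℕ-+ₙ a _) (cong (λ b → (toℕ a + b) % n) toℕ--ₙ1)

  col-bwd-suc : ∀ {x X c} → lay x ≡ X → col x ≡ suc c → col (x · bwd X) ≡ c
  col-bwd-suc {x} {X} {c} lx cx = begin
    col (x · bwd X)       ≡⟨ col-bwd {x} lx ⟩
    (col x + suc m) % n   ≡⟨ cong (λ d → (d + suc m) % n) cx ⟩
    (suc c + suc m) % n   ≡⟨ cong (_% n) (sym (+-suc c (suc m))) ⟩
    (c + n) % n           ≡⟨ [m+n]%n≡m%n c n ⟩
    c % n                 ≡⟨ m<n⇒m%n≡m (<-trans (n<1+n c) (subst (_< n) cx (toℕ<n (proj₁ x)))) ⟩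
    c                     ∎
    where open ≡-Reasoning

  col-bwd-zero : ∀ {x X} → lay x ≡ X → col x ≡ 0 → col (x · bwd X) ≡ n ∸ 1
  col-bwd-zero {x} lx cx = trans (col-bwd {x} lx) (trans (cong (λ d → (d + suc m) % n) cx) (m<n⇒m%n≡m ≤-refl))

  lay-fwd : ∀ {x X} → lay x ≡ X → lay (x · fwd X) ≡ X
  lay-fwd {_ , false} refl = refl
  lay-fwd {_ , true}  refl = refl

  lay-bwd : ∀ {x X} → lay x ≡ X → lay (x · bwd X) ≡ X
  lay-bwd {_ , false} refl = refl
  lay-bwd {_ , true}  refl = refl

  toℕ-+ₙ0 : ∀ a → toℕ (a +ₙ (0 mod n)) ≡ toℕ a
  toℕ-+ₙ0 a = trans (toℕ-+ₙ a _) (trans (cong (_% n) (+-identityʳ (toℕ a))) (m<n⇒m%n≡m (toℕ<n a)))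

  col-s : ∀ x → col (x · s) ≡ col x
  col-s (a , false) = toℕ-+ₙ0 a
  col-s (a , true)  = trans (cong (λ b → toℕ (a +ₙ b)) -ₙ0) (toℕ-+ₙ0 a)

  lay-s : ∀ x → lay (x · s) ≡ not (lay x)
  lay-s (_ , false) = refl
  lay-s (_ , true)  = refl

  move-cases : ∀ X {m} → m ∈ Moves → m ≡ fwd X ⊎ m ≡ s ⊎ m ≡ bwd X
  move-cases false (here refl)                         = inj₁ refl
  move-cases true  (here refl)                         = inj₂ (inj₂ refl)
  move-cases _     (there (here refl))                 = inj₂ (inj₁ refl)
  move-cases false (there (there (here refl)))         = inj₂ (inj₂ refl)
  move-cases true  (there (there (here refl)))         = inj₁ refl
  move-cases _     (there (there (there (here refl)))) = inj₂ (inj₁ refl)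

  fwd-∈ : ∀ X → fwd X ∈ Moves
  fwd-∈ false = here refl
  fwd-∈ true  = there (there (here refl))

  bwd-∈ : ∀ X → bwd X ∈ Moves
  bwd-∈ false = there (there (here refl))
  bwd-∈ true  = here refl

  s-∈ : s ∈ Moves
  s-∈ = there (here refl)

  fwd⁻¹ : ∀ X → fwd X ⁻¹ ≡ bwd X
  fwd⁻¹ false = refl
  fwd⁻¹ true  = cong (_, false) (-ₙ-involutive (1 mod n))

  s-after-fwd : ∀ X → Legal (just (fwd X)) s
  s-after-fwd false ()
  s-after-fwd true  ()

  s-after-bwd : ∀ X → Legal (just (bwd X)) s
  s-after-bwd false ()
  s-after-bwd true  ()

  fwd-after-s : ∀ X → Legal (just s) (fwd X)
  fwd-after-s false ()
  fwd-after-s true  ()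

  bwd-after-s : ∀ X → Legal (just s) (bwd X)
  bwd-after-s false ()
  bwd-after-s true  ()

  -- The reflection r^a s^b ↦ r^(-a) s^b reduces the openings through r⁻¹ to those through r.
  φ : D → D
  φ (a , b) = -ₙ a , b

  col-φ : ∀ x → col (φ x) ≡ (n ∸ col x) % n
  col-φ (a , _) = toℕ--ₙ a

  φ-involutive : ∀ x → φ (φ x) ≡ x
  φ-involutive (a , b) = cong (_, b) (-ₙ-involutive a)

  φ-homo : ∀ x y → φ (x · y) ≡ φ x · φ y
  φ-homo (a , false) (b , g) = cong (_, g) (-ₙ-distrib-+ₙ a b)
  φ-homo (a , true)  (b , g) = cong (_, not g) (-ₙ-distrib-+ₙ a (-ₙ b))

  φ-⁻¹ : ∀ x → φ (x ⁻¹) ≡ φ x ⁻¹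
  φ-⁻¹ (_ , false) = refl
  φ-⁻¹ (_ , true)  = refl

  φ-moves : ∀ {m} → m ∈ Moves → φ m ∈ Moves
  φ-moves (here refl)                         = there (there (here refl))
  φ-moves (there (here refl))                 = there (here (cong (_, true) -ₙ0))
  φ-moves (there (there (here refl)))         = here (cong (_, false) (-ₙ-involutive (1 mod n)))
  φ-moves (there (there (there (here refl)))) = there (here (cong (_, true) -ₙ0))

  φ-bwd : ∀ X → φ (bwd X) ≡ fwd X
  φ-bwd false = cong (_, false) (-ₙ-involutive (1 mod n))
  φ-bwd true  = refl

  open Automorphism {D} {_·_} {_⁻¹} {e} {r ∷ s ∷ []} φ φ-involutive φ-homo φ-⁻¹ φ-moves public

-- Which cells of column 0 have been visited: the one in the current layer, the other one, or both.
data Start : Set where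
  same other both : Start

sameVisited otherVisited : Start → Bool
sameVisited same  = true
sameVisited other = false
sameVisited both  = true
otherVisited same  = false
otherVisited other = true
otherVisited both  = true

flip : Start → Start
flip same  = other
flip other = same
flip both  = both

sameVisited-flip : ∀ z → sameVisited (flip z) ≡ otherVisited z
sameVisited-flip same  = refl
sameVisited-flip other = refl
sameVisited-flip both  = refl

otherVisited-flip : ∀ z → otherVisited (flip z) ≡ sameVisited z
otherVisited-flip same  = refl
otherVisited-flip other = refl
otherVisited-flip both  = refl

otherVisited-unless-same : ∀ z → sameVisited z ≡ false → otherVisited z ≡ true
otherVisited-unless-same other _ = refl

-- Whether the player to move wins from a corridor position t + 1 columns before wrapping round:
-- step forward (the opponent then faces a fresh corridor position), or cross to the other layer,
-- which pays off only if stepping back there is no immediate revisit (p = false) and the opponent,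
-- forced forward, loses.
moverWins : ℕ → Bool → Start → Bool
moverWins zero    p z = sameVisited z
moverWins (suc t) p z = not (moverWins t false z) ∨ (not p ∧ moverWins t true (flip z))

moverWins-6 : ∀ t p z → moverWins (6 + t) p z ≡ moverWins t p z
moverWins-6 zero    false same  = refl
moverWins-6 zero    false other = refl
moverWins-6 zero    false both  = refl
moverWins-6 zero    true  same  = refl
moverWins-6 zero    true  other = refl
moverWins-6 zero    true  both  = refl
moverWins-6 (suc t) p     z     =
  cong₂ (λ a b → not a ∨ (not p ∧ b)) (moverWins-6 t false z) (moverWins-6 t true (flip z))

moverWins-periodic : ∀ q t p z → moverWins (q * 6 + t) p z ≡ moverWins t p z
moverWins-periodic zero    t p z = refl
moverWins-periodic (suc q) t p z = trans (moverWins-6 (q * 6 + t) p z) (moverWins-periodic q t p z)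

-- straight and crossing are the corridor outcomes after the openings r and s r⁻¹.
Verdict : ℕ → ℕ → Bool → Bool → Set
Verdict parity residue straight crossing =
  (parity ≡ 1 → straight ≡ false) ×
  (parity ≡ 0 → (residue ≡ 2 → crossing ≡ true) × (residue ≢ 2 → straight ≡ true × crossing ≡ false))

Verdict-cong : ∀ {a a′ b b′ c c′ d d′} → a ≡ a′ → b ≡ b′ → c ≡ c′ → d ≡ d′ →
               Verdict a b c d → Verdict a′ b′ c′ d′
Verdict-cong refl refl refl refl v = v

VerdictFor : ℕ → Set
VerdictFor t = Verdict ((2 + t) % 2) ((2 + t) % 6) (moverWins t false same) (moverWins t true both)

verdict-small : ∀ ρ → ρ < 6 → VerdictFor ρ
verdict-small 0 _ = (λ ()) , λ _ → (λ _ → refl) , λ 2≢2 → ⊥-elim (2≢2 refl)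
verdict-small 1 _ = (λ _ → refl) , λ ()
verdict-small 2 _ = (λ ()) , λ _ → (λ ()) , λ _ → refl , refl
verdict-small 3 _ = (λ _ → refl) , λ ()
verdict-small 4 _ = (λ ()) , λ _ → (λ ()) , λ _ → refl , refl
verdict-small 5 _ = (λ _ → refl) , λ ()
verdict-small (suc (suc (suc (suc (suc (suc _)))))) (s≤s (s≤s (s≤s (s≤s (s≤s (s≤s ()))))))

verdict : ∀ t → VerdictFor t
verdict t = subst VerdictFor (sym (m≡m%n+[m/n]*n t 6)) (by-residue (t % 6) (t / 6) (m%n<n t 6))
  where
  by-residue : ∀ ρ q → ρ < 6 → VerdictFor (ρ + q * 6)
  by-residue ρ q ρ<6 = Verdict-cong (sym parity) (sym residue) (sym (periodic false same)) (sym (periodic true both))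
                                   (verdict-small ρ ρ<6)
    where
    parity : (2 + (ρ + q * 6)) % 2 ≡ (2 + ρ) % 2
    parity = trans (cong (λ w → (2 + ρ + w) % 2) (sym (*-assoc q 3 2))) ([m+kn]%n≡m%n (2 + ρ) (q * 3) 2)

    residue : (2 + (ρ + q * 6)) % 6 ≡ (2 + ρ) % 6
    residue = [m+kn]%n≡m%n (2 + ρ) q 6

    periodic : ∀ p z → moverWins (ρ + q * 6) p z ≡ moverWins ρ p z
    periodic p z = trans (cong (λ u → moverWins u p z) (+-comm ρ (q * 6))) (moverWins-periodic q ρ p z)

module Prism (k : ℕ) where

  open Coordinates (suc k)

  not-b≢b : ∀ {b} → not b ≢ b
  not-b≢b e = not-¬ refl (sym e)

  n≢1+n : ∀ {c} → c ≢ suc c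
  n≢1+n e = 1+n≢n (sym e)

  fwd≢bwd : ∀ X → fwd X ≢ bwd X
  fwd≢bwd false r≡r⁻¹ with trans (cong col r≡r⁻¹) toℕ--ₙ1
  ... | ()
  fwd≢bwd true  r⁻¹≡r = fwd≢bwd false (sym r⁻¹≡r)

  fwd-after-fwd : ∀ X → Legal (just (fwd X)) (fwd X)
  fwd-after-fwd X eq = fwd≢bwd X (trans eq (fwd⁻¹ X))

  data Cell (c : ℕ) (b : Bool) (y : D) : Set where
    cell : col y ≡ c → lay y ≡ b → Cell c b y

  ∉-∷ : ∀ {x y} {h : List D} → x ≢ y → x ∉ h → x ∉ y ∷ h
  ∉-∷ x≢y _   (here x≡y)  = x≢y x≡y
  ∉-∷ _   x∉h (there x∈h) = x∉h x∈h

  Records : List D → (D → Set) → Bool → Set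
  Records h P true  = ∀ {y} → P y → y ∈ h
  Records h P false = ∀ {y} → P y → y ∉ h

  recorded : ∀ {h P b y} → b ≡ true → Records h P b → P y → y ∈ h
  recorded refl rec = rec

  unrecorded : ∀ {h P b y} → b ≡ false → Records h P b → P y → y ∉ h
  unrecorded refl rec = rec

  records-∷ : ∀ {h P a} b → Records h P b → (∀ {y} → P y → y ≢ a) → Records (a ∷ h) P b
  records-∷ true  rec _  Py = there (rec Py)
  records-∷ false rec ≢a Py = ∉-∷ (≢a Py) (rec Py)

  records-⊆ : ∀ {h P Q} b → Records h P b → (∀ {y} → Q y → P y) → Records h Q b
  records-⊆ true  rec Q⇒P = rec ∘ Q⇒P
  records-⊆ false rec Q⇒P = rec ∘ Q⇒P

  cell-≡ : ∀ {c b x y} → Cell c b x → Cell c b y → x ≡ y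
  cell-≡ (cell cx lx) (cell cy ly) = D-≡ (trans cx (sym cy)) (trans lx (sym ly))

  ≢-columns : ∀ {c d b b′ x y} → Cell c b x → Cell d b′ y → c ≢ d → x ≢ y
  ≢-columns (cell cx _) (cell cy _) c≢d x≡y = c≢d (trans (sym cx) (trans (cong col x≡y) cy))

  ≢-layers : ∀ {c d b b′ x y} → Cell c b x → Cell d b′ y → b ≢ b′ → x ≢ y
  ≢-layers (cell _ lx) (cell _ ly) b≢b′ x≡y = b≢b′ (trans (sym lx) (trans (cong lay x≡y) ly))

  cross-cell : ∀ {c b y} → Cell c b y → Cell c (not b) (y · s)
  cross-cell {y = y} (cell cy ly) = cell (trans (col-s y) cy) (trans (lay-s y) (cong not ly))

  fwd-cell : ∀ {c X y} → Cell c X y → Cell (suc c % n) X (y · fwd X)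
  fwd-cell {y = y} (cell cy ly) = cell (trans (col-fwd {y} ly) (cong (λ d → suc d % n) cy)) (lay-fwd {y} ly)

  bwd-cell : ∀ {c X y} → Cell (suc c) X y → Cell c X (y · bwd X)
  bwd-cell {y = y} (cell cy ly) = cell (col-bwd-suc {y} ly cy) (lay-bwd {y} ly)

  bwd-cell-zero : ∀ {X y} → Cell 0 X y → Cell (n ∸ 1) X (y · bwd X)
  bwd-cell-zero {y = y} (cell cy ly) = cell (col-bwd-zero {y} ly cy) (lay-bwd {y} ly)

  φ-cell : ∀ {c b y} → Cell c b y → Cell ((n ∸ c) % n) b (φ y)
  φ-cell {y = y} (cell cy ly) = cell (trans (col-φ y) (cong (λ d → (n ∸ d) % n) cy)) ly

  φ-cell-zero : ∀ {b y} → Cell 0 b y → Cell 0 b (φ y)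
  φ-cell-zero {b} {y} y∈cell = subst (λ d → Cell d b (φ y)) (n%n≡0 n) (φ-cell y∈cell)

  φ-cell-last : ∀ {b y} → Cell (n ∸ 1) b y → Cell 1 b (φ y)
  φ-cell-last {b} {y} y∈cell =
    subst (λ d → Cell (d % n) b (φ y)) (m∸[m∸n]≡n {n} {1} (s≤s z≤n)) (φ-cell y∈cell)

  beyond-cell : ∀ {c b y} → Cell (suc c) b y → c < col y
  beyond-cell (cell cy _) = subst (_ <_) (sym cy) ≤-refl

  ≢-beyond : ∀ {c b x y} → c < col x → Cell c b y → x ≢ y
  ≢-beyond c<x (cell cy _) x≡y = <-irrefl (sym (trans (cong col x≡y) cy)) c<x

  -- The history seen from column suc c of layer X: columns strictly between 0 and c are never
  -- entered again, so only the cells listed here matter.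
  record Corridor (h : List D) (c : ℕ) (X p : Bool) (z : Start) : Set where
    field
      ahead        : Records h (λ y → suc c < col y) false
      current      : Records h (Cell (suc c) X) true
      across       : Records h (Cell (suc c) (not X)) false
      behind       : Records h (Cell c X) true
      behindAcross : Records h (Cell c (not X)) p
      start        : Records h (Cell 0 X) (sameVisited z)
      startAcross  : Records h (Cell 0 (not X)) (otherVisited z)

  corridor-fwd : ∀ {h c X p z y} → Corridor h c X p z → Cell (suc (suc c)) X y →
                 Corridor (y ∷ h) (suc c) X false z
  corridor-fwd {c = c} {X} {z = z} C y∈cell = record
    { ahead        = records-∷ false (records-⊆ false ahead (<-trans (n<1+n (suc c))))
                       λ c<w → ≢-beyond c<w y∈cell
    ; current      = λ w∈cell → here (cell-≡ w∈cell y∈cell)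
    ; across       = records-∷ false (records-⊆ false ahead λ {w} → beyond-cell {y = w})
                       λ w∈cell → ≢-layers w∈cell y∈cell (not-b≢b)
    ; behind       = there ∘ current
    ; behindAcross = records-∷ false across λ w∈cell → ≢-columns w∈cell y∈cell n≢1+n
    ; start        = records-∷ (sameVisited z) start λ w∈cell → ≢-columns w∈cell y∈cell 0≢1+n
    ; startAcross  = records-∷ (otherVisited z) startAcross λ w∈cell → ≢-columns w∈cell y∈cell 0≢1+n
    }
    where open Corridor C

  corridor-switch : ∀ {h c X p z y y′} → Corridor h c X p z →
                    Cell (suc c) (not X) y → Cell (suc (suc c)) (not X) y′ →
                    Corridor (y′ ∷ y ∷ h) (suc c) (not X) true (flip z)
  corridor-switch {c = c} {X} {z = z} C y∈cell y′∈cell = record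
    { ahead        = records-∷ false (records-∷ false (records-⊆ false ahead (<-trans (n<1+n (suc c))))
                       λ c<w → ≢-beyond (<-trans (n<1+n (suc c)) c<w) y∈cell)
                       λ c<w → ≢-beyond c<w y′∈cell
    ; current      = λ w∈cell → here (cell-≡ w∈cell y′∈cell)
    ; across       = records-∷ false (records-∷ false (records-⊆ false ahead λ {w} → beyond-cell {y = w})
                       λ w∈cell → ≢-columns w∈cell y∈cell 1+n≢n)
                       λ w∈cell → ≢-layers w∈cell y′∈cell (not-b≢b)
    ; behind       = λ w∈cell → there (here (cell-≡ w∈cell y∈cell))
    ; behindAcross = λ { (cell cw lw) → there (there (current (cell cw (trans lw (not-involutive X))))) }
    ; start        = subst (Records _ _) (sym (sameVisited-flip z))
                       (records-∷ (otherVisited z) (records-∷ (otherVisited z) startAcross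
                         λ w∈cell → ≢-columns w∈cell y∈cell 0≢1+n)
                         λ w∈cell → ≢-columns w∈cell y′∈cell 0≢1+n)
    ; startAcross  = subst (Records _ _) (sym (otherVisited-flip z))
                       (records-∷ (sameVisited z) (records-∷ (sameVisited z)
                         (records-⊆ (sameVisited z) start λ { (cell cw lw) → cell cw (trans lw (not-involutive X)) })
                         λ w∈cell → ≢-columns w∈cell y∈cell 0≢1+n)
                         λ w∈cell → ≢-columns w∈cell y′∈cell 0≢1+n)
    }
    where open Corridor C

  corridor-initial : ∀ {X a b} → Cell 1 X a → Cell 0 X b → Corridor (a ∷ b ∷ []) 0 X false same
  corridor-initial {X} {a} {b} a∈cell b∈cell = record
    { ahead        = records-∷ false (records-∷ false (λ _ ())
                       λ 1<w → ≢-beyond (<-trans z<s 1<w) b∈cell)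
                       λ 1<w → ≢-beyond 1<w a∈cell
    ; current      = λ w∈cell → here (cell-≡ w∈cell a∈cell)
    ; across       = records-∷ false (records-∷ false (λ _ ())
                       λ w∈cell → ≢-columns w∈cell b∈cell λ ())
                       λ w∈cell → ≢-layers w∈cell a∈cell (not-b≢b)
    ; behind       = start-cell
    ; behindAcross = start-across
    ; start        = start-cell
    ; startAcross  = start-across
    }
    where
    start-cell : Records (a ∷ b ∷ []) (Cell 0 X) true
    start-cell w∈cell = there (here (cell-≡ w∈cell b∈cell))

    start-across : Records (a ∷ b ∷ []) (Cell 0 (not X)) false
    start-across = records-∷ false (records-∷ false (λ _ ())
                     λ w∈cell → ≢-layers w∈cell b∈cell (not-b≢b))
                     λ w∈cell → ≢-columns w∈cell a∈cell 0≢1+n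

  corridor-initial-both : ∀ {X a b d} → Cell 1 X a → Cell 0 X b → Cell 0 (not X) d →
                          Corridor (a ∷ b ∷ d ∷ []) 0 X true both
  corridor-initial-both {X} {a} {b} {d} a∈cell b∈cell d∈cell = record
    { ahead        = records-∷ false (records-∷ false (records-∷ false (λ _ ())
                       λ 1<w → ≢-beyond (<-trans z<s 1<w) d∈cell)
                       λ 1<w → ≢-beyond (<-trans z<s 1<w) b∈cell)
                       λ 1<w → ≢-beyond 1<w a∈cell
    ; current      = λ w∈cell → here (cell-≡ w∈cell a∈cell)
    ; across       = records-∷ false (records-∷ false (records-∷ false (λ _ ())
                       λ w∈cell → ≢-columns w∈cell d∈cell λ ())
                       λ w∈cell → ≢-columns w∈cell b∈cell λ ())
                       λ w∈cell → ≢-layers w∈cell a∈cell (not-b≢b)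
    ; behind       = start-cell
    ; behindAcross = start-across
    ; start        = start-cell
    ; startAcross  = start-across
    }
    where
    start-cell : Records (a ∷ b ∷ d ∷ []) (Cell 0 X) true
    start-cell w∈cell = there (here (cell-≡ w∈cell b∈cell))

    start-across : Records (a ∷ b ∷ d ∷ []) (Cell 0 (not X)) true
    start-across w∈cell = there (there (here (cell-≡ w∈cell d∈cell)))

  Outcome : Bool → List D → D → Maybe D → Set
  Outcome true  = Win
  Outcome false = Lose

  outcome-≡ : ∀ {a b h x l} → a ≡ b → Outcome a h x l → Outcome b h x l
  outcome-≡ refl o = o

  module Position {h c X p z x} (C : Corridor h c X p z) (x∈cell : Cell (suc c) X x) where

    open Corridor C

    forward crossed crossed-forward crossed-back : D
    forward         = x · fwd X
    crossed         = x · s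
    crossed-forward = crossed · fwd (not X)
    crossed-back    = crossed · bwd (not X)

    crossed∈cell : Cell (suc c) (not X) crossed
    crossed∈cell = cross-cell x∈cell

    crossed-back∈cell : Cell c (not X) crossed-back
    crossed-back∈cell = bwd-cell crossed∈cell

    forward∈cell : Cell (suc (suc c) % n) X forward
    forward∈cell = fwd-cell x∈cell

    crossed-forward∈cell : Cell (suc (suc c) % n) (not X) crossed-forward
    crossed-forward∈cell = fwd-cell crossed∈cell

    crossed∉ : crossed ∉ h
    crossed∉ = across crossed∈cell

    win-fwd : forward ∈ h ⊎ Lose (forward ∷ h) forward (just (fwd X)) → Win h x (just (fwd X))
    win-fwd = win (fwd X) (fwd-∈ X) (fwd-after-fwd X)

    crossed-reply-fwd : crossed-forward ∈ crossed ∷ h ⊎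
                        Lose (crossed-forward ∷ crossed ∷ h) crossed-forward (just (fwd (not X))) →
                        Win (crossed ∷ h) crossed (just s)
    crossed-reply-fwd = win (fwd (not X)) (fwd-∈ (not X)) (fwd-after-s (not X))

    crossed-reply-bwd : p ≡ true → Win (crossed ∷ h) crossed (just s)
    crossed-reply-bwd p≡true =
      win (bwd (not X)) (bwd-∈ (not X)) (bwd-after-s (not X)) (inj₁ (there (recorded p≡true behindAcross crossed-back∈cell)))

    lose-all : forward ∉ h → Win (forward ∷ h) forward (just (fwd X)) → Win (crossed ∷ h) crossed (just s) →
               Lose h x (just (fwd X))
    lose-all forward∉ forward-won crossed-won = lose reply
      where
      reply : ∀ m → m ∈ Moves → Legal (just (fwd X)) m → (x · m) ∉ h × Win ((x · m) ∷ h) (x · m) (just m)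
      reply m m∈ legal with move-cases X m∈
      ... | inj₁ refl        = forward∉ , forward-won
      ... | inj₂ (inj₁ refl) = crossed∉ , crossed-won
      ... | inj₂ (inj₂ refl) = ⊥-elim (legal (sym (fwd⁻¹ X)))

    win-cross : p ≡ false → crossed-forward ∉ crossed ∷ h →
                Win (crossed-forward ∷ crossed ∷ h) crossed-forward (just (fwd (not X))) → Win h x (just (fwd X))
    win-cross p≡false crossed-forward∉ crossed-forward-won = win s s-∈ (s-after-fwd X) (inj₂ (lose reply))
      where
      back-across : Cell c X (crossed-back · s)
      back-across = subst (λ b → Cell c b (crossed-back · s)) (not-involutive X) (cross-cell crossed-back∈cell)

      reply : ∀ m → m ∈ Moves → Legal (just s) m →
              (crossed · m) ∉ crossed ∷ h × Win ((crossed · m) ∷ crossed ∷ h) (crossed · m) (just m)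
      reply m m∈ legal with move-cases (not X) m∈
      ... | inj₁ refl        = crossed-forward∉ , crossed-forward-won
      ... | inj₂ (inj₁ refl) = ⊥-elim (legal refl)
      ... | inj₂ (inj₂ refl) =
        records-∷ false (unrecorded p≡false behindAcross) (λ w∈cell → ≢-columns w∈cell crossed∈cell n≢1+n)
          crossed-back∈cell ,
        win s s-∈ (s-after-bwd (not X)) (inj₁ (there (there (behind back-across))))

    corridor-step : ∀ a q b → p ≡ q → forward ∉ h → crossed-forward ∉ crossed ∷ h →
              Outcome a (forward ∷ h) forward (just (fwd X)) →
              Outcome b (crossed-forward ∷ crossed ∷ h) crossed-forward (just (fwd (not X))) →
              Outcome (not a ∨ (not q ∧ b)) h x (just (fwd X))
    corridor-step false _     _     _  _        _ forward-lost _ = win-fwd (inj₂ forward-lost)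
    corridor-step true  true  _     p≡ forward∉ _ forward-won  _ = lose-all forward∉ forward-won (crossed-reply-bwd p≡)
    corridor-step true  false true  p≡ _ crossed-forward∉ _ crossed-forward-won =
      win-cross p≡ crossed-forward∉ crossed-forward-won
    corridor-step true  false false _  forward∉ _ forward-won crossed-forward-lost =
      lose-all forward∉ forward-won (crossed-reply-fwd (inj₂ crossed-forward-lost))

  corridor-outcome : ∀ t {h c X p z x} → t + suc (suc c) ≡ n → Corridor h c X p z → Cell (suc c) X x →
                     Outcome (moverWins t p z) h x (just (fwd X))
  corridor-outcome zero {h} {c} {X} {z = z} {x} wraps C x∈cell = at-last-column (sameVisited z) refl
    where
    open Corridor C
    open Position C x∈cell

    to-start : suc (suc c) % n ≡ 0
    to-start = trans (cong (_% n) wraps) (n%n≡0 n)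

    forward∈start : Cell 0 X forward
    forward∈start = subst (λ d → Cell d X forward) to-start forward∈cell

    crossed-forward∈start : Cell 0 (not X) crossed-forward
    crossed-forward∈start = subst (λ d → Cell d (not X) crossed-forward) to-start crossed-forward∈cell

    at-last-column : ∀ b → sameVisited z ≡ b → Outcome b h x (just (fwd X))
    at-last-column true  visited = win-fwd (inj₁ (recorded visited start forward∈start))
    at-last-column false fresh   =
      lose-all (unrecorded fresh start forward∈start)
        (win s s-∈ (s-after-fwd X) (inj₁ (there (recorded other-visited startAcross (cross-cell forward∈start)))))
        (crossed-reply-fwd (inj₁ (there (recorded other-visited startAcross crossed-forward∈start))))
      where
      other-visited = otherVisited-unless-same z fresh
  corridor-outcome (suc t) {h} {c} {X} {p} {z} inside C x∈cell =
    corridor-step (moverWins t false z) p (moverWins t true (flip z)) refl forward∉ crossed-forward∉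
      (corridor-outcome t inside′ (corridor-fwd C forward∈next) forward∈next)
      (corridor-outcome t inside′ (corridor-switch C crossed∈cell crossed-forward∈next) crossed-forward∈next)
    where
    open Corridor C
    open Position C x∈cell

    to-next : suc (suc c) % n ≡ suc (suc c)
    to-next = m<n⇒m%n≡m (subst (suc (suc c) <_) inside (s≤s (m≤n+m (suc (suc c)) t)))

    inside′ : t + suc (suc (suc c)) ≡ n
    inside′ = trans (+-suc t (suc (suc c))) inside

    forward∈next : Cell (suc (suc c)) X forward
    forward∈next = subst (λ d → Cell d X forward) to-next forward∈cell

    crossed-forward∈next : Cell (suc (suc c)) (not X) crossed-forward
    crossed-forward∈next = subst (λ d → Cell d (not X) crossed-forward) to-next crossed-forward∈cell

    forward∉ : forward ∉ h
    forward∉ = ahead (beyond-cell forward∈next)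

    crossed-forward∉ : crossed-forward ∉ crossed ∷ h
    crossed-forward∉ = records-∷ false ahead (λ c<w → ≢-beyond c<w crossed∈cell) (beyond-cell crossed-forward∈next)

  win-reflected : ∀ {h x X} → Win (map φ h) (φ x) (just (fwd X)) → Win h x (just (bwd X))
  win-reflected {X = X} w = win-φ⁻ (subst (λ m → Win _ _ (just m)) (sym (φ-bwd X)) w)

  e∈cell : Cell 0 false e
  e∈cell = cell refl refl

  opening-distance : suc k + 2 ≡ n
  opening-distance = +-comm (suc k) 2

  s∈cell : Cell 0 true (e · s)
  s∈cell = cross-cell e∈cell

  after-r : Outcome (moverWins (suc k) false same) (e · r ∷ e ∷ []) (e · r) (just r)
  after-r = corridor-outcome (suc k) opening-distance (corridor-initial (fwd-cell e∈cell) e∈cell) (fwd-cell e∈cell)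

  after-s-r⁻¹ : Outcome (moverWins (suc k) true both)
                        ((e · s) · (r ⁻¹) ∷ e · s ∷ e ∷ []) ((e · s) · (r ⁻¹)) (just (r ⁻¹))
  after-s-r⁻¹ = corridor-outcome (suc k) opening-distance
    (corridor-initial-both (fwd-cell s∈cell) s∈cell e∈cell) (fwd-cell s∈cell)

  after-r⁻¹ : moverWins (suc k) false same ≡ true → Win (e · (r ⁻¹) ∷ e ∷ []) (e · (r ⁻¹)) (just (r ⁻¹))
  after-r⁻¹ won = win-reflected {X = false} (outcome-≡ won (corridor-outcome (suc k) opening-distance
    (corridor-initial (φ-cell-last (bwd-cell-zero e∈cell)) (φ-cell-zero e∈cell)) (φ-cell-last (bwd-cell-zero e∈cell))))

  after-s-r : moverWins (suc k) true both ≡ true → Win ((e · s) · r ∷ e · s ∷ e ∷ []) ((e · s) · r) (just r)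
  after-s-r won = win-reflected {X = true} (outcome-≡ won (corridor-outcome (suc k) opening-distance
    (corridor-initial-both (φ-cell-last (bwd-cell-zero s∈cell)) (φ-cell-zero s∈cell) (φ-cell-zero e∈cell))
    (φ-cell-last (bwd-cell-zero s∈cell))))

  player1-by-r : moverWins (suc k) false same ≡ false → Player1Wins
  player1-by-r lost = win r (here refl) tt (inj₂ (outcome-≡ lost after-r))

  player1-by-s : moverWins (suc k) true both ≡ true → Player1Wins
  player1-by-s won = win s s-∈ tt (inj₂ (lose reply))
    where
    off-start : ∀ {c b y} → Cell (suc c) b y → y ∉ e · s ∷ e ∷ []
    off-start y∈cell = ∉-∷ (≢-columns y∈cell s∈cell λ ()) (∉-∷ (≢-columns y∈cell e∈cell λ ()) λ ())

    reply : ∀ m → m ∈ Moves → Legal (just s) m →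
            (e · s) · m ∉ e · s ∷ e ∷ [] × Win ((e · s) · m ∷ e · s ∷ e ∷ []) ((e · s) · m) (just m)
    reply m m∈ legal with move-cases true m∈
    ... | inj₁ refl        = off-start (fwd-cell s∈cell) , outcome-≡ won after-s-r⁻¹
    ... | inj₂ (inj₁ refl) = ⊥-elim (legal refl)
    ... | inj₂ (inj₂ refl) = off-start (bwd-cell-zero s∈cell) , after-s-r won

  player2-wins : moverWins (suc k) false same ≡ true → moverWins (suc k) true both ≡ false → Player2Wins
  player2-wins won lost = lose reply
    where
    off-start : ∀ {c b y} → Cell (suc c) b y → y ∉ e ∷ []
    off-start y∈cell = ∉-∷ (≢-columns y∈cell e∈cell λ ()) λ ()

    reply : ∀ m → m ∈ Moves → Legal nothing m → e · m ∉ e ∷ [] × Win (e · m ∷ e ∷ []) (e · m) (just m)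
    reply m m∈ _ with move-cases false m∈
    ... | inj₁ refl        = off-start (fwd-cell e∈cell) , outcome-≡ won after-r
    ... | inj₂ (inj₁ refl) = ∉-∷ (≢-layers s∈cell e∈cell λ ()) (λ ()) ,
                             win (fwd true) (fwd-∈ true) (fwd-after-s true) (inj₂ (outcome-≡ lost after-s-r⁻¹))
    ... | inj₂ (inj₂ refl) = off-start (bwd-cell-zero e∈cell) , after-r⁻¹ won

theorem3p2 : (n : ℕ) .{{_ : NonZero n}} → 3 ≤ n →
    (n % 2 ≡ 1 → P1WinsDihedral n) ×
    (n % 2 ≡ 0 → (n % 6 ≡ 2 → P1WinsDihedral n) × (n % 6 ≢ 2 → P2WinsDihedral n))
theorem3p2 (suc (suc (suc k))) (s≤s (s≤s (s≤s z≤n))) with verdict (suc k)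
... | odd⇒lost , even⇒ =
  (λ odd → player1-by-r (odd⇒lost odd)) ,
  λ even → let two⇒won , other⇒outcomes = even⇒ even
           in  (λ two → player1-by-s (two⇒won two)) , (λ not-two → uncurry player2-wins (other⇒outcomes not-two))
  where open Prism k
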